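{- Let $\lambda$ be a nonzero real number. For integers $n\ge 0$ let $(x)_{0,\mu}=1$ and $(x)_{n,\mu}=x(x-\mu)\cdots(x-(n-1)\mu)$ for $n\ge1$, for any nonzero parameter $\mu$. Define the degenerate Eulerian polynomials with parameter $\mu$ by $\sum_{j=0}^{\infty}(j+1)_{n,\mu}x^{j}=\frac{A_{n,\mu}(x)}{(1-x)^{n+1}}$ for $|x|<1$, and the degenerate Eulerian numbers by $A_{n,\mu}(x)=\sum_{k=0}^{n}A_{\mu}(n,k)x^{k}$. Then for all positive integers $m,n$, \[\sum_{k=1}^{m}(k)_{n,\lambda}=\sum_{j=0}^{n}A_{ -\lambda}(n,j)\binom{m+j+1}{n+1}.\]
   Context: $A_{ -\lambda}(n,j)$ is the degenerate Eulerian number with parameter $\mu=-\lambda$. -}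

module Defs where

open import Level using (Level)
open import Algebra.Bundles using (CommutativeRing)
open import Data.Nat using (ℕ; zero; suc; _∸_) renaming (_+_ to _+ℕ_)
open import Data.Nat.Combinatorics using (_C_)

module _ {c ℓ : Level} (R : CommutativeRing c ℓ) where
  open CommutativeRing R

  fromℕ : ℕ → Carrier
  fromℕ zero = 0#
  fromℕ (suc n) = 1# + fromℕ n

  sgn : ℕ → Carrier
  sgn zero = 1#
  sgn (suc i) = - (sgn i)

  fallDeg : Carrier → Carrier → ℕ → Carrier
  fallDeg x μ zero = 1#
  fallDeg x μ (suc n) = fallDeg x μ n * (x - fromℕ n * μ)

  sum0 : ℕ → (ℕ → Carrier) → Carrier
  sum0 zero f = f 0
  sum0 (suc n) f = sum0 n f + f (suc n)

  sum1 : ℕ → (ℕ → Carrier) → Carrier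
  sum1 zero f = 0#
  sum1 (suc m) f = sum1 m f + f (suc m)

  -- Degenerate Eulerian number A_μ(n,k): coefficient of x^k in
  --   A_{n,μ}(x) = (1 - x)^{n+1} · Σ_{j≥0} (j+1)_{n,μ} x^j   (formal power series product),
  -- i.e.  A_μ(n,k) = Σ_{i=0}^{k} (-1)^i C(n+1,i) (k-i+1)_{n,μ}.
  eulerDeg : Carrier → ℕ → ℕ → Carrier
  eulerDeg μ n k =
    sum0 k (λ i → sgn i * fromℕ (suc n C i) * fallDeg (fromℕ (suc (k ∸ i))) μ n)

{-# OPTIONS --safe #-}
module Submission where

-- Worpitzky's identity (x)_{n,λ} = Σ_k A_{-λ}(n,k) C(x+k,n) holds for every natural x, so
-- summing over x = 1..m with Pascal's rule gives the theorem; the boundary terms vanish because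
-- A_μ(n,k) = 0 for k > n and A_μ(n,n) = 0 for n ≥ 1.  Worpitzky's identity follows by induction
-- on n from the recurrence
--   A_μ(n+1,k) = (k+1-nμ) A_μ(n,k) + (n+1-k+nμ) A_μ(n,k-1),
-- which comes from reading A_μ(n,·) as the Cauchy product of the coefficients of (1-x)^(n+1)
-- with ((j+1)_{n,μ})_j: multiplying the latter by j+1-nμ is the operator x d/dx + 1 - nμ, and
-- the product rule moves it onto (1-x)^(n+1).

open import Defs
open import Level using (Level)
open import Algebra.Bundles using (CommutativeRing)
open import Algebra.Solver.Ring.AlmostCommutativeRing
  using (fromCommutativeRing; _-Raw-AlmostCommutative⟶_)
open import Data.Nat using (ℕ; zero; suc; _∸_; _≤_; _<_; z≤n; s≤s)
  renaming (_+_ to _+ℕ_; _*_ to _*ℕ_)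
import Data.Nat.Properties as ℕₚ
open import Data.Nat.Combinatorics using (_C_; nCk+nC[k+1]≡[n+1]C[k+1]; k>n⇒nCk≡0; nC1≡n)
open import Data.Integer as ℤ using (ℤ; +_; -[1+_]; _⊖_; _◃_; sign; ∣_∣)
open import Data.Integer.Properties using ([1+m]⊖[1+n]≡m⊖n; ◃-inverse) renaming (_≟_ to _≟ℤ_)
open import Data.Sign as Sign using (Sign)
open import Data.Maybe using (map)
open import Function using (_∘_)
open import Relation.Binary.Consequences using (dec⇒weaklyDec)
open import Relation.Binary.Definitions using (WeaklyDecidable)
open import Relation.Binary.PropositionalEquality as ≡ using (_≡_)
open import Relation.Nullary using (¬_)

[1+k]*[1+n]C[1+k]≡[1+n]*nCk : ∀ n k → suc k *ℕ (suc n C suc k) ≡ suc n *ℕ (n C k)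
[1+k]*[1+n]C[1+k]≡[1+n]*nCk n zero = begin
  1 *ℕ (suc n C 1) ≡⟨ ℕₚ.*-identityˡ _ ⟩
  suc n C 1        ≡⟨ nC1≡n (suc n) ⟩
  suc n            ≡⟨ ℕₚ.*-identityʳ (suc n) ⟨
  suc n *ℕ 1       ∎
  where open ≡.≡-Reasoning
[1+k]*[1+n]C[1+k]≡[1+n]*nCk zero (suc k) = ℕₚ.*-zeroʳ (suc (suc k))
[1+k]*[1+n]C[1+k]≡[1+n]*nCk (suc n) (suc k) = begin
  suc (suc k) *ℕ (suc (suc n) C suc (suc k))
    ≡⟨ ≡.cong (suc (suc k) *ℕ_) (nCk+nC[k+1]≡[n+1]C[k+1] (suc n) (suc k)) ⟨
  suc (suc k) *ℕ (a +ℕ b)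
    ≡⟨ ℕₚ.*-distribˡ-+ (suc (suc k)) a b ⟩
  a +ℕ suc k *ℕ a +ℕ suc (suc k) *ℕ b
    ≡⟨ ≡.cong₂ (λ p q → a +ℕ p +ℕ q) ([1+k]*[1+n]C[1+k]≡[1+n]*nCk n k)
                                       ([1+k]*[1+n]C[1+k]≡[1+n]*nCk n (suc k)) ⟩
  a +ℕ suc n *ℕ (n C k) +ℕ suc n *ℕ (n C suc k)
    ≡⟨ ℕₚ.+-assoc a _ _ ⟩
  a +ℕ (suc n *ℕ (n C k) +ℕ suc n *ℕ (n C suc k))
    ≡⟨ ≡.cong (a +ℕ_) (ℕₚ.*-distribˡ-+ (suc n) (n C k) (n C suc k)) ⟨
  a +ℕ suc n *ℕ (n C k +ℕ n C suc k)
    ≡⟨ ≡.cong (λ p → a +ℕ suc n *ℕ p) (nCk+nC[k+1]≡[n+1]C[k+1] n k) ⟩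
  suc (suc n) *ℕ a ∎
  where
  open ≡.≡-Reasoning
  a = suc n C suc k
  b = suc n C suc (suc k)

module IntegerCoefficients {c ℓ : Level} (R : CommutativeRing c ℓ) where
  open CommutativeRing R
  open import Algebra.Properties.Ring ring using (-0#≈0#; -‿+-comm; -‿involutive; -1*x≈-x)
  open import Algebra.Properties.Semiring.Mult.TCOptimised semiring
    using (_×_; 1+×; ×-homo-+; ×1-homo-*)
  open import Algebra.Properties.CommutativeSemigroup +-commutativeSemigroup
    using () renaming (interchange to +-interchange)
  open import Algebra.Properties.CommutativeSemigroup *-commutativeSemigroup
    using () renaming (interchange to *-interchange)
  open import Relation.Binary.Reasoning.Setoid setoid

  -- Built on the optimised _×_, for which 1 × 1# is 1#, so that the solver constants
  -- con (+ 0) and con (+ 1) denote 0# and 1# definitionally.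
  fromℤ : ℤ → Carrier
  fromℤ (+ n)    = n × 1#
  fromℤ -[1+ n ] = - (suc n × 1#)

  fromℤ-⊖ : ∀ m n → fromℤ (m ⊖ n) ≈ m × 1# - n × 1#
  fromℤ-⊖ zero    zero    = sym (trans (+-identityˡ _) -0#≈0#)
  fromℤ-⊖ zero    (suc n) = sym (+-identityˡ _)
  fromℤ-⊖ (suc m) zero    = sym (trans (+-congˡ -0#≈0#) (+-identityʳ _))
  fromℤ-⊖ (suc m) (suc n) = begin
    fromℤ (suc m ⊖ suc n)                  ≡⟨ ≡.cong fromℤ ([1+m]⊖[1+n]≡m⊖n m n) ⟩
    fromℤ (m ⊖ n)                          ≈⟨ fromℤ-⊖ m n ⟩
    m × 1# + - (n × 1#)                    ≈⟨ +-identityˡ _ ⟨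
    0# + (m × 1# + - (n × 1#))             ≈⟨ +-congʳ (-‿inverseʳ 1#) ⟨
    (1# + - 1#) + (m × 1# + - (n × 1#))    ≈⟨ +-interchange _ _ _ _ ⟩
    (1# + m × 1#) + (- 1# + - (n × 1#))    ≈⟨ +-cong (1+× m 1#) (sym (-‿+-comm 1# _)) ⟨
    suc m × 1# - (1# + n × 1#)             ≈⟨ +-congˡ (-‿cong (1+× n 1#)) ⟨
    suc m × 1# - suc n × 1#                ∎

  fromℤ-+ : ∀ i j → fromℤ (i ℤ.+ j) ≈ fromℤ i + fromℤ j
  fromℤ-+ (+ m)    (+ n)    = ×-homo-+ 1# m n
  fromℤ-+ (+ m)    -[1+ n ] = fromℤ-⊖ m (suc n)
  fromℤ-+ -[1+ m ] (+ n)    = trans (fromℤ-⊖ n (suc m)) (+-comm _ _)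
  fromℤ-+ -[1+ m ] -[1+ n ] = begin
    - (suc (suc (m +ℕ n)) × 1#)          ≡⟨ ≡.cong (λ k → - (suc k × 1#)) (ℕₚ.+-suc m n) ⟨
    - ((suc m +ℕ suc n) × 1#)            ≈⟨ -‿cong (×-homo-+ 1# (suc m) (suc n)) ⟩
    - (suc m × 1# + suc n × 1#)          ≈⟨ -‿+-comm _ _ ⟨
    - (suc m × 1#) + - (suc n × 1#)      ∎

  fromℤ-neg : ∀ i → fromℤ (ℤ.- i) ≈ - fromℤ i
  fromℤ-neg (+ zero)  = sym -0#≈0#
  fromℤ-neg (+ suc n) = refl
  fromℤ-neg -[1+ n ]  = sym (-‿involutive _)

  fromSign : Sign → Carrier
  fromSign Sign.+ = 1#
  fromSign Sign.- = - 1#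

  fromSign-* : ∀ s t → fromSign (s Sign.* t) ≈ fromSign s * fromSign t
  fromSign-* Sign.+ t      = sym (*-identityˡ _)
  fromSign-* Sign.- Sign.+ = sym (*-identityʳ _)
  fromSign-* Sign.- Sign.- = sym (trans (-1*x≈-x _) (-‿involutive _))

  fromℤ-◃ : ∀ s n → fromℤ (s ◃ n) ≈ fromSign s * (n × 1#)
  fromℤ-◃ s      zero    = sym (zeroʳ _)
  fromℤ-◃ Sign.+ (suc n) = sym (*-identityˡ _)
  fromℤ-◃ Sign.- (suc n) = sym (-1*x≈-x _)

  fromℤ-* : ∀ i j → fromℤ (i ℤ.* j) ≈ fromℤ i * fromℤ j
  fromℤ-* i j = begin
    fromℤ (sign i Sign.* sign j ◃ ∣ i ∣ *ℕ ∣ j ∣)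
      ≈⟨ fromℤ-◃ (sign i Sign.* sign j) (∣ i ∣ *ℕ ∣ j ∣) ⟩
    fromSign (sign i Sign.* sign j) * ((∣ i ∣ *ℕ ∣ j ∣) × 1#)
      ≈⟨ *-cong (fromSign-* (sign i) (sign j)) (×1-homo-* ∣ i ∣ ∣ j ∣) ⟩
    (fromSign (sign i) * fromSign (sign j)) * (∣ i ∣ × 1# * ∣ j ∣ × 1#)
      ≈⟨ *-interchange _ _ _ _ ⟩
    (fromSign (sign i) * ∣ i ∣ × 1#) * (fromSign (sign j) * ∣ j ∣ × 1#)
      ≈⟨ *-cong (fromℤ-◃ (sign i) ∣ i ∣) (fromℤ-◃ (sign j) ∣ j ∣) ⟨
    fromℤ (sign i ◃ ∣ i ∣) * fromℤ (sign j ◃ ∣ j ∣)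
      ≡⟨ ≡.cong₂ (λ p q → fromℤ p * fromℤ q) (◃-inverse i) (◃-inverse j) ⟩
    fromℤ i * fromℤ j ∎

  fromℤ-morphism : ℤ.+-*-rawRing -Raw-AlmostCommutative⟶ fromCommutativeRing R
  fromℤ-morphism = record
    { ⟦_⟧    = fromℤ
    ; +-homo = fromℤ-+
    ; *-homo = fromℤ-*
    ; -‿homo = fromℤ-neg
    ; 0-homo = refl
    ; 1-homo = refl
    }

  fromℤ-≟ : WeaklyDecidable (λ i j → fromℤ i ≈ fromℤ j)
  fromℤ-≟ i j = map (reflexive ∘ ≡.cong fromℤ) (dec⇒weaklyDec _≟ℤ_ i j)

  open import Algebra.Solver.Ring ℤ.+-*-rawRing (fromCommutativeRing R) fromℤ-morphism fromℤ-≟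
    public

module DegenerateEulerian {r ℓ : Level} (R : CommutativeRing r ℓ) where
  open CommutativeRing R
  open IntegerCoefficients R using (Polynomial; solve; _:=_; con; _:+_; _:*_; _:-_; :-_)
  open import Algebra.Properties.Ring ring using (-1*x≈-x)
  open import Algebra.Properties.CommutativeSemigroup +-commutativeSemigroup using (interchange)
  open import Relation.Binary.Reasoning.Setoid setoid

  ι : ℕ → Carrier
  ι = fromℕ R

  ι-+ : ∀ m n → ι (m +ℕ n) ≈ ι m + ι n
  ι-+ zero    n = sym (+-identityˡ _)
  ι-+ (suc m) n = trans (+-congˡ (ι-+ m n)) (sym (+-assoc _ _ _))

  ι-* : ∀ m n → ι (m *ℕ n) ≈ ι m * ι n
  ι-* zero    n = sym (zeroˡ _)
  ι-* (suc m) n = begin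
    ι (n +ℕ m *ℕ n)         ≈⟨ trans (ι-+ n (m *ℕ n)) (+-congˡ (ι-* m n)) ⟩
    ι n + ι m * ι n         ≈⟨ +-congʳ (*-identityˡ _) ⟨
    1# * ι n + ι m * ι n    ≈⟨ distribʳ _ _ _ ⟨
    (1# + ι m) * ι n        ∎

  :0 :1 : ∀ {k} → Polynomial k
  :0 = con (+ 0)
  :1 = con (+ 1)

  sum0-cong : ∀ n {f g : ℕ → Carrier} → (∀ i → f i ≈ g i) → sum0 R n f ≈ sum0 R n g
  sum0-cong zero    f≈g = f≈g 0
  sum0-cong (suc n) f≈g = +-cong (sum0-cong n f≈g) (f≈g (suc n))

  sum0-+ : ∀ n (f g : ℕ → Carrier) → sum0 R n (λ i → f i + g i) ≈ sum0 R n f + sum0 R n g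
  sum0-+ zero    f g = refl
  sum0-+ (suc n) f g = trans (+-congʳ (sum0-+ n f g)) (interchange _ _ _ _)

  sum0-*ʳ : ∀ n (f : ℕ → Carrier) a → sum0 R n f * a ≈ sum0 R n (λ i → f i * a)
  sum0-*ʳ zero    f a = refl
  sum0-*ʳ (suc n) f a = trans (distribʳ _ _ _) (+-congʳ (sum0-*ʳ n f a))

  sum0-head : ∀ n (f : ℕ → Carrier) → sum0 R (suc n) f ≈ f 0 + sum0 R n (f ∘ suc)
  sum0-head zero    f = refl
  sum0-head (suc n) f = trans (+-congʳ (sum0-head n f)) (+-assoc _ _ _)

  sum0-vanish : ∀ n (f : ℕ → Carrier) → (∀ i → i ≤ n → f i ≈ 0#) → sum0 R n f ≈ 0#
  sum0-vanish zero    f f≈0 = f≈0 0 z≤n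
  sum0-vanish (suc n) f f≈0 = begin
    sum0 R n f + f (suc n)
      ≈⟨ +-cong (sum0-vanish n f (λ i i≤n → f≈0 i (ℕₚ.m≤n⇒m≤1+n i≤n)))
                (f≈0 (suc n) ℕₚ.≤-refl) ⟩
    0# + 0#
      ≈⟨ +-identityˡ 0# ⟩
    0# ∎

  sum0-reindex-+ : ∀ n (f g : ℕ → Carrier) → f (suc n) ≈ 0# → g 0 ≈ 0# →
                   sum0 R (suc n) (λ i → f i + g i) ≈ sum0 R n (λ i → f i + g (suc i))
  sum0-reindex-+ n f g f[1+n]≈0 g0≈0 = begin
    sum0 R (suc n) (λ i → f i + g i)              ≈⟨ sum0-+ (suc n) f g ⟩
    (sum0 R n f + f (suc n)) + sum0 R (suc n) g   ≈⟨ +-cong drop-last drop-first ⟩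
    sum0 R n f + sum0 R n (g ∘ suc)               ≈⟨ sum0-+ n f (g ∘ suc) ⟨
    sum0 R n (λ i → f i + g (suc i))              ∎
    where
    drop-last : sum0 R n f + f (suc n) ≈ sum0 R n f
    drop-last = trans (+-congˡ f[1+n]≈0) (+-identityʳ _)
    drop-first : sum0 R (suc n) g ≈ sum0 R n (g ∘ suc)
    drop-first = trans (sum0-head n g) (trans (+-congʳ g0≈0) (+-identityˡ _))

  cauchy : (ℕ → Carrier) → (ℕ → Carrier) → ℕ → Carrier
  cauchy u v zero    = u 0 * v 0
  cauchy u v (suc k) = u 0 * v (suc k) + cauchy (u ∘ suc) v k

  sum0≈cauchy : ∀ k (u v : ℕ → Carrier) → sum0 R k (λ i → u i * v (k ∸ i)) ≈ cauchy u v k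
  sum0≈cauchy zero    u v = refl
  sum0≈cauchy (suc k) u v =
    trans (sum0-head k (λ i → u i * v (suc k ∸ i))) (+-congˡ (sum0≈cauchy k (u ∘ suc) v))

  cauchy-cong : ∀ k {u u′ v v′ : ℕ → Carrier} →
                (∀ i → u i ≈ u′ i) → (∀ j → v j ≈ v′ j) → cauchy u v k ≈ cauchy u′ v′ k
  cauchy-cong zero    u≈u′ v≈v′ = *-cong (u≈u′ 0) (v≈v′ 0)
  cauchy-cong (suc k) u≈u′ v≈v′ =
    +-cong (*-cong (u≈u′ 0) (v≈v′ (suc k))) (cauchy-cong k (u≈u′ ∘ suc) v≈v′)

  cauchy-+ˡ : ∀ k (u u′ v : ℕ → Carrier) →
              cauchy (λ i → u i + u′ i) v k ≈ cauchy u v k + cauchy u′ v k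
  cauchy-+ˡ zero    u u′ v = distribʳ _ _ _
  cauchy-+ˡ (suc k) u u′ v =
    trans (+-cong (distribʳ _ _ _) (cauchy-+ˡ k (u ∘ suc) (u′ ∘ suc) v)) (interchange _ _ _ _)

  cauchy-*ˡ : ∀ k a (u v : ℕ → Carrier) → cauchy (λ i → a * u i) v k ≈ a * cauchy u v k
  cauchy-*ˡ zero    a u v = *-assoc _ _ _
  cauchy-*ˡ (suc k) a u v =
    trans (+-cong (*-assoc _ _ _) (cauchy-*ˡ k a (u ∘ suc) v)) (sym (distribˡ _ _ _))

  cauchy-negˡ : ∀ k (u v : ℕ → Carrier) → cauchy (λ i → - u i) v k ≈ - cauchy u v k
  cauchy-negˡ k u v = begin
    cauchy (λ i → - u i) v k      ≈⟨ cauchy-cong k (λ i → sym (-1*x≈-x (u i))) (λ _ → refl) ⟩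
    cauchy (λ i → - 1# * u i) v k ≈⟨ cauchy-*ˡ k (- 1#) u v ⟩
    - 1# * cauchy u v k           ≈⟨ -1*x≈-x _ ⟩
    - cauchy u v k                ∎

  cauchy-zeroˡ : ∀ k (u v : ℕ → Carrier) → (∀ i → u i ≈ 0#) → cauchy u v k ≈ 0#
  cauchy-zeroˡ zero    u v u≈0 = trans (*-congʳ (u≈0 0)) (zeroˡ _)
  cauchy-zeroˡ (suc k) u v u≈0 = trans
    (+-cong (trans (*-congʳ (u≈0 0)) (zeroˡ _)) (cauchy-zeroˡ k (u ∘ suc) v (u≈0 ∘ suc)))
    (+-identityˡ 0#)

  shift : (ℕ → Carrier) → ℕ → Carrier
  shift u zero    = 0#
  shift u (suc i) = u i

  cauchy-shift : ∀ k (u v : ℕ → Carrier) → cauchy (shift u) v (suc k) ≈ cauchy u v k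
  cauchy-shift k u v = trans (+-congʳ (zeroˡ _)) (+-identityˡ _)

  -- The product rule for the operator x d/dx + a on power series.
  cauchy-leibniz : ∀ k a (u v : ℕ → Carrier) →
    (ι k + a) * cauchy u v k ≈ cauchy (λ i → ι i * u i) v k + cauchy u (λ j → (ι j + a) * v j) k
  cauchy-leibniz zero a u v =
    solve 3 (λ a u₀ v₀ → (:0 :+ a) :* (u₀ :* v₀) := :0 :* u₀ :* v₀ :+ u₀ :* ((:0 :+ a) :* v₀))
            refl a (u 0) (v 0)
  cauchy-leibniz (suc k) a u v = begin
    (ι (suc k) + a) * (u 0 * v (suc k) + X)
      ≈⟨ solve 6 (λ K a u₀ v₁ X Y →
                    ((:1 :+ K) :+ a) :* (u₀ :* v₁ :+ X)
                    := (:0 :* u₀ :* v₁ :+ (X :+ Y))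
                         :+ (u₀ :* (((:1 :+ K) :+ a) :* v₁) :+ ((K :+ a) :* X :- Y)))
                 refl (ι k) a (u 0) (v (suc k)) X Y ⟩
    (ι 0 * u 0 * v (suc k) + (X + Y)) + (u 0 * ((ι (suc k) + a) * v (suc k)) + ((ι k + a) * X - Y))
      ≈⟨ +-cong (+-congˡ (sym weight-suc)) (+-congˡ leibniz-tail) ⟩
    cauchy (λ i → ι i * u i) v (suc k) + cauchy u (λ j → (ι j + a) * v j) (suc k) ∎
    where
    X Y Z : Carrier
    X = cauchy (u ∘ suc) v k
    Y = cauchy (λ i → ι i * u (suc i)) v k
    Z = cauchy (u ∘ suc) (λ j → (ι j + a) * v j) k
    weight-suc : cauchy (λ i → ι (suc i) * u (suc i)) v k ≈ X + Y
    weight-suc = trans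
      (cauchy-cong k (λ i → trans (distribʳ _ _ _) (+-congʳ (*-identityˡ _))) (λ _ → refl))
      (cauchy-+ˡ k (u ∘ suc) (λ i → ι i * u (suc i)) v)
    leibniz-tail : (ι k + a) * X - Y ≈ Z
    leibniz-tail = begin
      (ι k + a) * X - Y ≈⟨ +-congʳ (cauchy-leibniz k a (u ∘ suc) v) ⟩
      (Y + Z) - Y       ≈⟨ solve 2 (λ Y Z → (Y :+ Z) :- Y := Z) refl Y Z ⟩
      Z                 ∎

  signedBinomial : ℕ → ℕ → Carrier
  signedBinomial n i = sgn R i * ι (suc n C i)

  signedBinomial-pascal : ∀ n i →
    signedBinomial (suc n) i ≈ signedBinomial n i - shift (signedBinomial n) i
  signedBinomial-pascal n zero    = solve 0 (:1 :* (:1 :+ :0) := :1 :* (:1 :+ :0) :- :0) refl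
  signedBinomial-pascal n (suc i) = begin
    - s * ι (suc (suc n) C suc i)
      ≡⟨ ≡.cong (λ m → - s * ι m) (nCk+nC[k+1]≡[n+1]C[k+1] (suc n) i) ⟨
    - s * ι (suc n C i +ℕ suc n C suc i)
      ≈⟨ *-congˡ (ι-+ (suc n C i) (suc n C suc i)) ⟩
    - s * (ι (suc n C i) + ι (suc n C suc i))
      ≈⟨ solve 3 (λ s p q → (:- s) :* (p :+ q) := (:- s) :* q :- s :* p)
                 refl s (ι (suc n C i)) (ι (suc n C suc i)) ⟩
    - s * ι (suc n C suc i) - s * ι (suc n C i) ∎
    where
    s = sgn R i

  signedBinomial-absorb : ∀ n i →
    ι i * signedBinomial (suc n) i ≈ (- ι (suc (suc n))) * shift (signedBinomial n) i
  signedBinomial-absorb n zero    = trans (zeroˡ _) (sym (zeroʳ _))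
  signedBinomial-absorb n (suc i) = begin
    ι (suc i) * (- s * ι (suc (suc n) C suc i))
      ≈⟨ solve 3 (λ a s q → a :* ((:- s) :* q) := (:- s) :* (a :* q))
                 refl (ι (suc i)) s (ι (suc (suc n) C suc i)) ⟩
    - s * (ι (suc i) * ι (suc (suc n) C suc i))
      ≈⟨ *-congˡ (ι-* (suc i) (suc (suc n) C suc i)) ⟨
    - s * ι (suc i *ℕ (suc (suc n) C suc i))
      ≡⟨ ≡.cong (λ m → - s * ι m) ([1+k]*[1+n]C[1+k]≡[1+n]*nCk (suc n) i) ⟩
    - s * ι (suc (suc n) *ℕ (suc n C i))
      ≈⟨ *-congˡ (ι-* (suc (suc n)) (suc n C i)) ⟩
    - s * (ι (suc (suc n)) * ι (suc n C i))
      ≈⟨ solve 3 (λ N s p → (:- s) :* (N :* p) := (:- N) :* (s :* p))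
                 refl (ι (suc (suc n))) s (ι (suc n C i)) ⟩
    (- ι (suc (suc n))) * (s * ι (suc n C i)) ∎
    where
    s = sgn R i

  eulerDeg≈cauchy : ∀ μ n k →
    eulerDeg R μ n k ≈ cauchy (signedBinomial n) (λ j → fallDeg R (ι (suc j)) μ n) k
  eulerDeg≈cauchy μ n k = sum0≈cauchy k (signedBinomial n) (λ j → fallDeg R (ι (suc j)) μ n)

  eulerPrev : Carrier → ℕ → ℕ → Carrier
  eulerPrev μ n zero    = 0#
  eulerPrev μ n (suc k) = eulerDeg R μ n k

  eulerPrev≈cauchy-shift : ∀ μ n k →
    eulerPrev μ n k ≈ cauchy (shift (signedBinomial n)) (λ j → fallDeg R (ι (suc j)) μ n) k
  eulerPrev≈cauchy-shift μ n zero    = sym (zeroˡ _)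
  eulerPrev≈cauchy-shift μ n (suc k) = trans (eulerDeg≈cauchy μ n k) (sym (cauchy-shift k _ _))

  eulerDeg-suc : ∀ μ n k → eulerDeg R μ (suc n) k ≈
    (ι (suc k) - ι n * μ) * eulerDeg R μ n k + (ι (suc n) - ι k + ι n * μ) * eulerPrev μ n k
  eulerDeg-suc μ n k = begin
    eulerDeg R μ (suc n) k
      ≈⟨ trans (eulerDeg≈cauchy μ (suc n) k) (cauchy-cong k (λ _ → refl) weight) ⟩
    U
      ≈⟨ solve 2 (λ U W → U := W :+ U :- W) refl U W ⟩
    W + U - W
      ≈⟨ +-congʳ (cauchy-leibniz k a c′ f) ⟨
    (ι k + a) * cauchy c′ f k - W
      ≈⟨ +-cong (*-congˡ pascal) (-‿cong absorb) ⟩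
    (ι k + a) * (A - P) - (- ι (suc (suc n))) * P
      ≈⟨ solve 5 (λ K N μ A P → (K :+ (:1 :- N :* μ)) :* (A :- P) :- (:- (:1 :+ (:1 :+ N))) :* P
                               := ((:1 :+ K) :- N :* μ) :* A :+ (((:1 :+ N) :- K) :+ N :* μ) :* P)
                 refl (ι k) (ι n) μ A P ⟩
    (ι (suc k) - ι n * μ) * A + (ι (suc n) - ι k + ι n * μ) * P ∎
    where
    c c′ f : ℕ → Carrier
    c  = signedBinomial n
    c′ = signedBinomial (suc n)
    f  = λ j → fallDeg R (ι (suc j)) μ n
    a A P U W : Carrier
    a = 1# - ι n * μ
    A = eulerDeg R μ n k
    P = eulerPrev μ n k
    U = cauchy c′ (λ j → (ι j + a) * f j) k
    W = cauchy (λ i → ι i * c′ i) f k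
    weight : ∀ j → f j * (ι (suc j) - ι n * μ) ≈ (ι j + a) * f j
    weight j = solve 4 (λ F J N μ → F :* ((:1 :+ J) :- N :* μ) := (J :+ (:1 :- N :* μ)) :* F)
                       refl (f j) (ι j) (ι n) μ
    pascal : cauchy c′ f k ≈ A - P
    pascal = begin
      cauchy c′ f k
        ≈⟨ cauchy-cong k (signedBinomial-pascal n) (λ _ → refl) ⟩
      cauchy (λ i → c i - shift c i) f k
        ≈⟨ cauchy-+ˡ k c (λ i → - shift c i) f ⟩
      cauchy c f k + cauchy (λ i → - shift c i) f k
        ≈⟨ +-cong (sym (eulerDeg≈cauchy μ n k)) (cauchy-negˡ k (shift c) f) ⟩
      A - cauchy (shift c) f k
        ≈⟨ +-congˡ (-‿cong (eulerPrev≈cauchy-shift μ n k)) ⟨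
      A - P ∎
    absorb : W ≈ (- ι (suc (suc n))) * P
    absorb = begin
      W
        ≈⟨ cauchy-cong k (signedBinomial-absorb n) (λ _ → refl) ⟩
      cauchy (λ i → (- ι (suc (suc n))) * shift c i) f k
        ≈⟨ cauchy-*ˡ k _ (shift c) f ⟩
      (- ι (suc (suc n))) * cauchy (shift c) f k
        ≈⟨ *-congˡ (eulerPrev≈cauchy-shift μ n k) ⟨
      (- ι (suc (suc n))) * P ∎

  eulerDeg-zero-suc : ∀ μ k → eulerDeg R μ 0 (suc k) ≈ 0#
  eulerDeg-zero-suc μ k = begin
    eulerDeg R μ 0 (suc k)
      ≈⟨ eulerDeg≈cauchy μ 0 (suc k) ⟩
    c 0 * 1# + cauchy (c ∘ suc) f k
      ≈⟨ +-congˡ (tail k) ⟩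
    c 0 * 1# + c 1 * 1#
      ≈⟨ solve 0 (:1 :* (:1 :+ :0) :* :1 :+ (:- :1) :* (:1 :+ :0) :* :1 := :0) refl ⟩
    0# ∎
    where
    c f : ℕ → Carrier
    c = signedBinomial 0
    f = λ j → fallDeg R (ι (suc j)) μ 0
    tail : ∀ k → cauchy (c ∘ suc) f k ≈ c 1 * 1#
    tail zero    = refl
    tail (suc k) =
      trans (+-congˡ (cauchy-zeroˡ k (c ∘ suc ∘ suc) f (λ _ → zeroʳ _))) (+-identityʳ _)

  eulerDeg-vanish : ∀ μ n k → n < k → eulerDeg R μ n k ≈ 0#
  eulerDeg-vanish μ zero    (suc k) _         = eulerDeg-zero-suc μ k
  eulerDeg-vanish μ (suc n) (suc k) (s≤s n<k) = begin
    eulerDeg R μ (suc n) (suc k)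
      ≈⟨ eulerDeg-suc μ n (suc k) ⟩
    a * eulerDeg R μ n (suc k) + b * eulerDeg R μ n k
      ≈⟨ +-cong (*-congˡ (eulerDeg-vanish μ n (suc k) (ℕₚ.m<n⇒m<1+n n<k)))
                (*-congˡ (eulerDeg-vanish μ n k n<k)) ⟩
    a * 0# + b * 0#
      ≈⟨ trans (+-cong (zeroʳ a) (zeroʳ b)) (+-identityˡ 0#) ⟩
    0# ∎
    where
    a b : Carrier
    a = ι (suc (suc k)) - ι n * μ
    b = ι (suc n) - ι (suc k) + ι n * μ

  eulerDeg-suc-diagonal : ∀ μ n → eulerDeg R μ (suc n) (suc n) ≈ ι n * μ * eulerDeg R μ n n
  eulerDeg-suc-diagonal μ n = begin
    eulerDeg R μ (suc n) (suc n)
      ≈⟨ eulerDeg-suc μ n (suc n) ⟩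
    a * eulerDeg R μ n (suc n) + (ι (suc n) - ι (suc n) + ι n * μ) * A
      ≈⟨ +-congʳ (*-congˡ (eulerDeg-vanish μ n (suc n) ℕₚ.≤-refl)) ⟩
    a * 0# + (ι (suc n) - ι (suc n) + ι n * μ) * A
      ≈⟨ solve 4 (λ a N μ A → a :* :0 :+ (((:1 :+ N) :- (:1 :+ N)) :+ N :* μ) :* A := N :* μ :* A)
                 refl a (ι n) μ A ⟩
    ι n * μ * A ∎
    where
    a A : Carrier
    a = ι (suc (suc n)) - ι n * μ
    A = eulerDeg R μ n n

  eulerDeg-diagonal : ∀ μ n → eulerDeg R μ (suc n) (suc n) ≈ 0#
  eulerDeg-diagonal μ zero    =
    trans (eulerDeg-suc-diagonal μ 0) (solve 2 (λ μ A → :0 :* μ :* A := :0) refl μ _)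
  eulerDeg-diagonal μ (suc n) =
    trans (eulerDeg-suc-diagonal μ (suc n)) (trans (*-congˡ (eulerDeg-diagonal μ n)) (zeroʳ _))

  fallDeg-worpitzky : ∀ lam n x →
    fallDeg R (ι x) lam n ≈ sum0 R n (λ k → eulerDeg R (- lam) n k * ι ((x +ℕ k) C n))
  fallDeg-worpitzky lam zero    x = solve 0 (:1 := :1 :* (:1 :+ :0) :* :1 :* (:1 :+ :0)) refl
  fallDeg-worpitzky lam (suc n) x = begin
    fallDeg R (ι x) lam n * (ι x - ι n * lam)
      ≈⟨ *-congʳ (fallDeg-worpitzky lam n x) ⟩
    sum0 R n (λ k → A k * C₀ k) * (ι x - ι n * lam)
      ≈⟨ sum0-*ʳ n _ _ ⟩
    sum0 R n (λ k → A k * C₀ k * (ι x - ι n * lam))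
      ≈⟨ sum0-cong n split ⟨
    sum0 R n (λ k → P k + Q (suc k))
      ≈⟨ sum0-reindex-+ n P Q P[1+n]≈0 Q0≈0 ⟨
    sum0 R (suc n) (λ k → P k + Q k)
      ≈⟨ sum0-cong (suc n) (λ k → trans (*-congʳ (eulerDeg-suc μ n k)) (distribʳ _ _ _)) ⟨
    sum0 R (suc n) (λ k → eulerDeg R μ (suc n) k * C₁ k) ∎
    where
    μ : Carrier
    μ = - lam
    A C₀ C₁ P Q : ℕ → Carrier
    A k  = eulerDeg R μ n k
    C₀ k = ι ((x +ℕ k) C n)
    C₁ k = ι ((x +ℕ k) C suc n)
    P k  = (ι (suc k) - ι n * μ) * A k * C₁ k
    Q k  = (ι (suc n) - ι k + ι n * μ) * eulerPrev μ n k * C₁ k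
    P[1+n]≈0 : P (suc n) ≈ 0#
    P[1+n]≈0 = trans (*-congʳ (trans (*-congˡ (eulerDeg-vanish μ n (suc n) ℕₚ.≤-refl)) (zeroʳ _)))
                     (zeroˡ _)
    Q0≈0 : Q 0 ≈ 0#
    Q0≈0 = trans (*-congʳ (zeroʳ _)) (zeroˡ _)
    C₁-suc : ∀ k → C₁ (suc k) ≈ C₀ k + C₁ k
    C₁-suc k = begin
      ι ((x +ℕ suc k) C suc n)
        ≡⟨ ≡.cong (λ m → ι (m C suc n)) (ℕₚ.+-suc x k) ⟩
      ι (suc (x +ℕ k) C suc n)
        ≡⟨ ≡.cong ι (nCk+nC[k+1]≡[n+1]C[k+1] (x +ℕ k) n) ⟨
      ι ((x +ℕ k) C n +ℕ (x +ℕ k) C suc n)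
        ≈⟨ ι-+ ((x +ℕ k) C n) ((x +ℕ k) C suc n) ⟩
      C₀ k + C₁ k ∎
    absorption : ∀ k → ι (suc n) * (C₀ k + C₁ k) ≈ (1# + (ι x + ι k)) * C₀ k
    absorption k = begin
      ι (suc n) * (C₀ k + C₁ k)
        ≈⟨ *-congˡ (C₁-suc k) ⟨
      ι (suc n) * C₁ (suc k)
        ≡⟨ ≡.cong (λ m → ι (suc n) * ι (m C suc n)) (ℕₚ.+-suc x k) ⟩
      ι (suc n) * ι (suc (x +ℕ k) C suc n)
        ≈⟨ ι-* (suc n) (suc (x +ℕ k) C suc n) ⟨
      ι (suc n *ℕ (suc (x +ℕ k) C suc n))
        ≡⟨ ≡.cong ι ([1+k]*[1+n]C[1+k]≡[1+n]*nCk (x +ℕ k) n) ⟩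
      ι (suc (x +ℕ k) *ℕ ((x +ℕ k) C n))
        ≈⟨ ι-* (suc (x +ℕ k)) ((x +ℕ k) C n) ⟩
      (1# + ι (x +ℕ k)) * C₀ k
        ≈⟨ *-congʳ (+-congˡ (ι-+ x k)) ⟩
      (1# + (ι x + ι k)) * C₀ k ∎
    split : ∀ k → P k + Q (suc k) ≈ A k * C₀ k * (ι x - ι n * lam)
    split k = begin
      P k + Q (suc k)
        ≈⟨ +-congˡ (*-congˡ (C₁-suc k)) ⟩
      P k + (ι (suc n) - ι (suc k) + ι n * μ) * A k * (C₀ k + C₁ k)
        ≈⟨ solve 6 (λ K N l a c₀ c₁ →
                      ((:1 :+ K) :- N :* (:- l)) :* a :* c₁
                        :+ (((:1 :+ N) :- (:1 :+ K)) :+ N :* (:- l)) :* a :* (c₀ :+ c₁)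
                      := a :* ((:1 :+ N) :* (c₀ :+ c₁)) :- ((:1 :+ K) :+ N :* l) :* a :* c₀)
                   refl (ι k) (ι n) lam (A k) (C₀ k) (C₁ k) ⟩
      A k * (ι (suc n) * (C₀ k + C₁ k)) - (ι (suc k) + ι n * lam) * A k * C₀ k
        ≈⟨ +-congʳ (*-congˡ (absorption k)) ⟩
      A k * ((1# + (ι x + ι k)) * C₀ k) - (ι (suc k) + ι n * lam) * A k * C₀ k
        ≈⟨ solve 6 (λ X K N l a c₀ →
                      a :* ((:1 :+ (X :+ K)) :* c₀) :- ((:1 :+ K) :+ N :* l) :* a :* c₀
                      := a :* c₀ :* (X :- N :* l))
                   refl (ι x) (ι k) (ι n) lam (A k) (C₀ k) ⟩
      A k * C₀ k * (ι x - ι n * lam) ∎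

  sum1-fallDeg : ∀ lam n m →
    sum1 R m (λ k → fallDeg R (ι k) lam (suc n))
      ≈ sum0 R (suc n) (λ j → eulerDeg R (- lam) (suc n) j * ι ((m +ℕ j +ℕ 1) C suc (suc n)))
  sum1-fallDeg lam n zero = sym (begin
    sum0 R n T + T (suc n)
      ≈⟨ +-cong (sum0-vanish n T below-diagonal)
                (trans (*-congʳ (eulerDeg-diagonal (- lam) n)) (zeroˡ _)) ⟩
    0# + 0#
      ≈⟨ +-identityˡ 0# ⟩
    0# ∎)
    where
    E T : ℕ → Carrier
    E j = eulerDeg R (- lam) (suc n) j
    T j = E j * ι ((j +ℕ 1) C suc (suc n))
    below-diagonal : ∀ j → j ≤ n → T j ≈ 0#
    below-diagonal j j≤n = begin
      E j * ι ((j +ℕ 1) C suc (suc n))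
        ≡⟨ ≡.cong (λ i → E j * ι (i C suc (suc n))) (ℕₚ.+-comm j 1) ⟩
      E j * ι (suc j C suc (suc n))
        ≡⟨ ≡.cong (λ b → E j * ι b) (k>n⇒nCk≡0 (s≤s (s≤s j≤n))) ⟩
      E j * 0#
        ≈⟨ zeroʳ _ ⟩
      0# ∎
  sum1-fallDeg lam n (suc m) = begin
    sum1 R m F + F (suc m)
      ≈⟨ +-cong (sum1-fallDeg lam n m) (fallDeg-worpitzky lam (suc n) (suc m)) ⟩
    sum0 R (suc n) (λ j → E j * ι (B m j)) + sum0 R (suc n) (λ j → E j * ι ((suc m +ℕ j) C suc n))
      ≈⟨ sum0-+ (suc n) _ _ ⟨
    sum0 R (suc n) (λ j → E j * ι (B m j) + E j * ι ((suc m +ℕ j) C suc n))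
      ≈⟨ sum0-cong (suc n) pascal ⟩
    sum0 R (suc n) (λ j → E j * ι (B (suc m) j)) ∎
    where
    F E : ℕ → Carrier
    F k = fallDeg R (ι k) lam (suc n)
    E j = eulerDeg R (- lam) (suc n) j
    B : ℕ → ℕ → ℕ
    B m j = (m +ℕ j +ℕ 1) C suc (suc n)
    pascal : ∀ j → E j * ι (B m j) + E j * ι ((suc m +ℕ j) C suc n) ≈ E j * ι (B (suc m) j)
    pascal j = begin
      E j * ι (B m j) + E j * ι (suc (m +ℕ j) C suc n)
        ≈⟨ distribˡ _ _ _ ⟨
      E j * (ι (B m j) + ι (suc (m +ℕ j) C suc n))
        ≈⟨ *-congˡ (ι-+ (B m j) (suc (m +ℕ j) C suc n)) ⟨
      E j * ι (B m j +ℕ suc (m +ℕ j) C suc n)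
        ≡⟨ ≡.cong (λ i → E j * ι (B m j +ℕ i C suc n)) (ℕₚ.+-comm 1 (m +ℕ j)) ⟩
      E j * ι (B m j +ℕ (m +ℕ j +ℕ 1) C suc n)
        ≡⟨ ≡.cong (λ b → E j * ι b) (ℕₚ.+-comm (B m j) _) ⟩
      E j * ι ((m +ℕ j +ℕ 1) C suc n +ℕ B m j)
        ≡⟨ ≡.cong (λ b → E j * ι b) (nCk+nC[k+1]≡[n+1]C[k+1] (m +ℕ j +ℕ 1) (suc n)) ⟩
      E j * ι (B (suc m) j) ∎

theorem2p9 : {c ℓ : Level} (R : CommutativeRing c ℓ) →
    let open CommutativeRing R in
    (lam : Carrier) → ¬ (lam ≈ 0#) → (m n : ℕ) → 1 ≤ m → 1 ≤ n →
    sum1 R m (λ k → fallDeg R (fromℕ R k) lam n)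
      ≈ sum0 R n (λ j → eulerDeg R (- lam) n j * fromℕ R ((m +ℕ j +ℕ 1) C (suc n)))
theorem2p9 R lam _ m (suc n) _ _ = DegenerateEulerian.sum1-fallDeg R lam n m
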